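{- The number of distinct 3SUM-types of 3SUM instances of size $N$ is $2^{\Theta(N\log N)}$.
   Context: A 3SUM instance of size $N$ is a triple $\langle A,B,C\rangle$ of sets of $N$ real numbers each, written in increasing order $A=\{a_1<\dots<a_N\}$, $B=\{b_1<\dots<b_N\}$, $C=\{c_1<\dots<c_N\}$. Its 3SUM-type is the map $\chi:[N]^3\to\{ -,0,+\}$ given by $\chi(i,j,k)=\mathrm{sgn}(a_i+b_j+c_k)$.
   Formalization: The 3SUM instances $\langle A,B,C\rangle$ consist of rational numbers instead of real numbers, so the 3SUM-types counted are those of rational instances. -}

module Defs where

open import Data.Nat using (ℕ; suc; _≤_)
open import Data.Fin using (Fin)
open import Data.Fin.Base using () renaming (_<_ to _<ᶠ_)
open import Data.Rational using (ℚ; 0ℚ; _+_; _<_)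
open import Data.Rational.Properties using (_<?_)
open import Data.List using (List; length)
open import Data.List.Relation.Unary.All using (All)
open import Data.List.Relation.Unary.AllPairs using (AllPairs)
open import Data.Product using (Σ; ∃; ∃-syntax; _×_)
open import Relation.Binary.PropositionalEquality using (_≡_)
open import Relation.Nullary using (¬_; yes; no)

data Sgn : Set where
  neg zer pos : Sgn

sgn : ℚ → Sgn
sgn q with q <? 0ℚ
... | yes _ = neg
... | no _ with 0ℚ <? q
...   | yes _ = pos
...   | no _  = zer

StrictlyIncreasing : {N : ℕ} → (Fin N → ℚ) → Set
StrictlyIncreasing {N} a = ∀ (i j : Fin N) → i <ᶠ j → a i < a j

-- A 3SUM instance of size N: three sets A, B, C of N numbers each, in increasing order.
record Instance (N : ℕ) : Set where
  field
    a b c : Fin N → ℚ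
    a-inc : StrictlyIncreasing a
    b-inc : StrictlyIncreasing b
    c-inc : StrictlyIncreasing c

Type3 : ℕ → Set
Type3 N = Fin N → Fin N → Fin N → Sgn

typeOf : {N : ℕ} → Instance N → Type3 N
typeOf I i j k = sgn (a i + b j + c k) where open Instance I

_≈ᵗ_ : {N : ℕ} → Type3 N → Type3 N → Set
χ ≈ᵗ χ' = ∀ i j k → χ i j k ≡ χ' i j k

IsType : (N : ℕ) → Type3 N → Set
IsType N χ = ∃[ I ] (typeOf I ≈ᵗ χ)

DistinctTypes : (N : ℕ) → List (Type3 N) → Set
DistinctTypes N L = All (IsType N) L × AllPairs (λ χ χ' → ¬ (χ ≈ᵗ χ')) L

AtLeastTypes : ℕ → ℕ → Set
AtLeastTypes N m = ∃[ L ] (DistinctTypes N L × m ≤ length L)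

AtMostTypes : ℕ → ℕ → Set
AtMostTypes N m = ∀ L → DistinctTypes N L → length L ≤ m

{-# OPTIONS --safe #-}
-- A 3SUM-type is the sign pattern of the N³ linear forms xᵢ + yⱼ + zₖ on ℚ^(3N), evaluated
-- at the point (a, b, c). Any m linear forms on ℚ^d have at most (1 + 2m)^d realizable sign
-- patterns: split off one form f; a pattern is its tail (a pattern of the other forms) plus
-- one sign, and a tail with more than one extension is realized on the hyperplane f = 0
-- (directly, or by the crossing point of a segment from the −-side to the +-side), which is
-- a space of dimension d − 1. With m = N³ and d = 3N this is 2^O(N log N).
-- Conversely, for every f : [N] → {0, …, N} the instance aᵢ = (N+1)(i+1), bⱼ = j,
-- cₖ = (N+1)k + f(k) − ((N+1)N + N) satisfies a_{N−1−k} + bⱼ + cₖ = j + f(k) − N, so its type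
-- determines f; these (N+1)^N ≥ 2^(N ⌊log₂ N⌋) instances have pairwise distinct types.

module Submission where

open import Defs
open import Data.Bool using (Bool; true; false; _∨_; _∧_; T)
open import Data.Bool.Properties using (T-∨; T-∧)
open import Data.Fin using (Fin; zero; suc; toℕ; opposite; fromℕ<; combine; remQuot; finToFun; funToFin)
import Data.Fin.Properties as Finₚ
open import Data.List as List using (List; []; _∷_; length; allFin)
import Data.List.Membership.DecPropositional as DecMembership
import Data.List.Properties as Listₚ
open import Data.List.Relation.Unary.All as All using (All; []; _∷_)
open import Data.List.Relation.Unary.All.Properties as Allₚ using (All¬⇒¬Any)
import Data.List.Relation.Unary.AllPairs as AllPairs
open import Data.List.Relation.Unary.AllPairs using ([]; _∷_)
import Data.List.Relation.Unary.AllPairs.Properties as AllPairsₚ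
open import Data.List.Relation.Unary.Unique.Propositional using (Unique)
import Data.List.Relation.Unary.Unique.Propositional.Properties as Uniqueₚ
open import Data.Nat as ℕ using (ℕ; zero; suc; _+_; _*_; _^_; _∸_; _/_; _≤_; _<_; z≤n; s≤s; ⌊_/2⌋; ⌈_/2⌉)
open import Data.Nat.DivMod using (m/n≤m)
open import Data.Nat.Induction using (<-rec)
open import Data.Nat.Logarithm using (⌊log₂_⌋; ⌊log₂⌋-mono-≤; ⌊log₂[2^n]⌋≡n)
open import Data.Nat.Logarithm.Core using (⌊log2⌋-acc-irrelevant)
import Data.Nat.Properties as ℕₚ
open import Data.Nat.Tactic.RingSolver using () renaming (ring to ℕ-ring)
open import Data.Product using (∃-syntax; _×_; _,_; map₂)
open import Data.Rational as ℚ using (ℚ; 0ℚ; 1ℚ)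
import Data.Rational.Properties as ℚₚ
open import Data.Sum using (_⊎_; inj₁; inj₂)
open import Data.Vec as Vec using (Vec; []; _∷_; lookup; removeAt; zipWith; tabulate; replicate; _++_)
import Data.Vec.Properties as Vecₚ
open import Function using (_∘_; id)
open import Function.Bundles using (Equivalence)
open import Level using (0ℓ)
open import Relation.Binary using (DecidableEquality; tri<; tri≈; tri>)
open import Relation.Binary.PropositionalEquality
open import Relation.Nullary using (¬_; Dec; yes; no; does; contradiction)
open import Relation.Nullary.Decidable using (dec⇒maybe; dec-true)
open import Tactic.RingSolver using (solve-∀)
import Tactic.RingSolver.Core.AlmostCommutativeRing as ACR

private
  variable
    m d : ℕ
    p q : ℚ
    s : Sgn

ℚ-ring : ACR.AlmostCommutativeRing 0ℓ 0ℓ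
ℚ-ring = ACR.fromCommutativeRing ℚₚ.+-*-commutativeRing (λ x → dec⇒maybe (0ℚ ℚₚ.≟ x))

<0⇒sgn≡neg : q ℚ.< 0ℚ → sgn q ≡ neg
<0⇒sgn≡neg {q} q<0 with q ℚₚ.<? 0ℚ
... | yes _   = refl
... | no q≮0 = contradiction q<0 q≮0

>0⇒sgn≡pos : 0ℚ ℚ.< q → sgn q ≡ pos
>0⇒sgn≡pos {q} q>0 with q ℚₚ.<? 0ℚ
... | yes q<0 = contradiction q<0 (ℚₚ.<-asym q>0)
... | no _ with 0ℚ ℚₚ.<? q
...   | yes _   = refl
...   | no q≯0 = contradiction q>0 q≯0

sgn≡neg⇒<0 : sgn q ≡ neg → q ℚ.< 0ℚ
sgn≡neg⇒<0 {q} sgn≡neg with ℚₚ.<-cmp q 0ℚ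
... | tri< q<0 _ _  = q<0
... | tri≈ _ refl _ with () ← sgn≡neg
... | tri> _ _ q>0  with () ← trans (sym (>0⇒sgn≡pos q>0)) sgn≡neg

sgn≡zer⇒≡0 : sgn q ≡ zer → q ≡ 0ℚ
sgn≡zer⇒≡0 {q} sgn≡zer with ℚₚ.<-cmp q 0ℚ
... | tri< q<0 _ _  with () ← trans (sym (<0⇒sgn≡neg q<0)) sgn≡zer
... | tri≈ _ q≡0 _  = q≡0
... | tri> _ _ q>0  with () ← trans (sym (>0⇒sgn≡pos q>0)) sgn≡zer

sgn≡pos⇒>0 : sgn q ≡ pos → 0ℚ ℚ.< q
sgn≡pos⇒>0 {q} sgn≡pos with ℚₚ.<-cmp q 0ℚ
... | tri< q<0 _ _  with () ← trans (sym (<0⇒sgn≡neg q<0)) sgn≡pos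
... | tri≈ _ refl _ with () ← sgn≡pos
... | tri> _ _ q>0  = q>0

sgn-positiveCombination : ∀ {α β} → 0ℚ ℚ.< α → 0ℚ ℚ.< β →
                          sgn p ≡ s → sgn q ≡ s → sgn (α ℚ.* p ℚ.+ β ℚ.* q) ≡ s
sgn-positiveCombination {p} {neg} {q} {α} {β} α>0 β>0 sp sq = <0⇒sgn≡neg
  (ℚₚ.+-mono-< (*-neg α>0 (sgn≡neg⇒<0 {p} sp)) (*-neg β>0 (sgn≡neg⇒<0 {q} sq)))
  where
  *-neg : ∀ {γ r} → 0ℚ ℚ.< γ → r ℚ.< 0ℚ → γ ℚ.* r ℚ.< 0ℚ
  *-neg {γ} {r} γ>0 r<0 = subst (γ ℚ.* r ℚ.<_) (ℚₚ.*-zeroʳ γ) (ℚₚ.*-monoʳ-<-pos γ {{ℚ.positive γ>0}} r<0)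
sgn-positiveCombination {p} {zer} {q} {α} {β} _ _ sp sq
  with refl ← sgn≡zer⇒≡0 {p} sp | refl ← sgn≡zer⇒≡0 {q} sq =
  cong sgn (cong₂ ℚ._+_ (ℚₚ.*-zeroʳ α) (ℚₚ.*-zeroʳ β))
sgn-positiveCombination {p} {pos} {q} {α} {β} α>0 β>0 sp sq = >0⇒sgn≡pos
  (ℚₚ.+-mono-< (*-pos α>0 (sgn≡pos⇒>0 {p} sp)) (*-pos β>0 (sgn≡pos⇒>0 {q} sq)))
  where
  *-pos : ∀ {γ r} → 0ℚ ℚ.< γ → 0ℚ ℚ.< r → 0ℚ ℚ.< γ ℚ.* r
  *-pos {γ} {r} γ>0 r>0 = subst (ℚ._< γ ℚ.* r) (ℚₚ.*-zeroʳ γ) (ℚₚ.*-monoʳ-<-pos γ {{ℚ.positive γ>0}} r>0)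

-- Linear forms and their sign patterns

infixl 7 _·_

_·_ : Vec ℚ d → Vec ℚ d → ℚ
[]      · []      = 0ℚ
(a ∷ u) · (b ∷ v) = a ℚ.* b ℚ.+ u · v

lincomb : ℚ → Vec ℚ d → ℚ → Vec ℚ d → Vec ℚ d
lincomb α u β v = zipWith (λ a b → α ℚ.* a ℚ.+ β ℚ.* b) u v

·-lincombʳ : ∀ α β (f x y : Vec ℚ d) → f · lincomb α x β y ≡ α ℚ.* (f · x) ℚ.+ β ℚ.* (f · y)
·-lincombʳ α β []      []      []      = sym (cong₂ ℚ._+_ (ℚₚ.*-zeroʳ α) (ℚₚ.*-zeroʳ β))
·-lincombʳ α β (c ∷ f) (a ∷ x) (b ∷ y) rewrite ·-lincombʳ α β f x y =
  distrib α β c a b (f · x) (f · y)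
  where
  distrib : ∀ α β c a b r s → c ℚ.* (α ℚ.* a ℚ.+ β ℚ.* b) ℚ.+ (α ℚ.* r ℚ.+ β ℚ.* s)
                             ≡ α ℚ.* (c ℚ.* a ℚ.+ r) ℚ.+ β ℚ.* (c ℚ.* b ℚ.+ s)
  distrib = solve-∀ ℚ-ring

·-lincombˡ : ∀ α β (g f x : Vec ℚ d) → lincomb α g β f · x ≡ α ℚ.* (g · x) ℚ.+ β ℚ.* (f · x)
·-lincombˡ α β []      []      []      = sym (cong₂ ℚ._+_ (ℚₚ.*-zeroʳ α) (ℚₚ.*-zeroʳ β))
·-lincombˡ α β (a ∷ g) (b ∷ f) (c ∷ x) rewrite ·-lincombˡ α β g f x =
  distrib α β a b c (g · x) (f · x)
  where
  distrib : ∀ α β a b c r s → (α ℚ.* a ℚ.+ β ℚ.* b) ℚ.* c ℚ.+ (α ℚ.* r ℚ.+ β ℚ.* s)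
                             ≡ α ℚ.* (a ℚ.* c ℚ.+ r) ℚ.+ β ℚ.* (b ℚ.* c ℚ.+ s)
  distrib = solve-∀ ℚ-ring

·-removeAt : ∀ (g x : Vec ℚ (suc d)) t → lookup g t ≡ 0ℚ → g · x ≡ removeAt g t · removeAt x t
·-removeAt (a ∷ g) (b ∷ x) zero a≡0 rewrite a≡0 =
  trans (cong (ℚ._+ g · x) (ℚₚ.*-zeroˡ b)) (ℚₚ.+-identityˡ (g · x))
·-removeAt (a ∷ g@(_ ∷ _)) (b ∷ x@(_ ∷ _)) (suc t) gₜ≡0 = cong (a ℚ.* b ℚ.+_) (·-removeAt g x t gₜ≡0)

nonzeroCoefficient⊎vanishing : (f : Vec ℚ d) → (∃[ t ] lookup f t ≢ 0ℚ) ⊎ (∀ x → f · x ≡ 0ℚ)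
nonzeroCoefficient⊎vanishing []      = inj₂ λ { [] → refl }
nonzeroCoefficient⊎vanishing (a ∷ f) with a ℚₚ.≟ 0ℚ | nonzeroCoefficient⊎vanishing f
... | no a≢0   | _                = inj₁ (zero , a≢0)
... | yes _    | inj₁ (t , fₜ≢0)  = inj₁ (suc t , fₜ≢0)
... | yes refl | inj₂ f≡0         = inj₂ λ { (b ∷ x) → cong₂ ℚ._+_ (ℚₚ.*-zeroˡ b) (f≡0 x) }

eliminate : (f : Vec ℚ (suc d)) (t : Fin (suc d)) .{{_ : ℚ.NonZero (lookup f t)}} →
            Vec ℚ (suc d) → Vec ℚ d
eliminate f t g = removeAt (lincomb 1ℚ g (ℚ.- (lookup g t ℚ.* ℚ.1/ lookup f t)) f) t

·-eliminate : ∀ (f : Vec ℚ (suc d)) t .{{_ : ℚ.NonZero (lookup f t)}} g x →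
              f · x ≡ 0ℚ → eliminate f t g · removeAt x t ≡ g · x
·-eliminate f t g x f·x≡0 = begin
  eliminate f t g · removeAt x t      ≡⟨ ·-removeAt (lincomb 1ℚ g c f) x t coefficient≡0 ⟨
  lincomb 1ℚ g c f · x                ≡⟨ ·-lincombˡ 1ℚ c g f x ⟩
  1ℚ ℚ.* (g · x) ℚ.+ c ℚ.* (f · x)    ≡⟨ cong (λ z → 1ℚ ℚ.* (g · x) ℚ.+ c ℚ.* z) f·x≡0 ⟩
  1ℚ ℚ.* (g · x) ℚ.+ c ℚ.* 0ℚ         ≡⟨ simplify (g · x) c ⟩
  g · x                               ∎
  where
  open ≡-Reasoning
  fₜ = lookup f t
  gₜ = lookup g t
  c = ℚ.- (gₜ ℚ.* ℚ.1/ fₜ)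
  simplify : ∀ a b → 1ℚ ℚ.* a ℚ.+ b ℚ.* 0ℚ ≡ a
  simplify = solve-∀ ℚ-ring
  rearrange : ∀ a u v → 1ℚ ℚ.* a ℚ.+ ℚ.- (a ℚ.* u) ℚ.* v ≡ a ℚ.+ ℚ.- (a ℚ.* (u ℚ.* v))
  rearrange = solve-∀ ℚ-ring
  cancel : ∀ a → a ℚ.+ ℚ.- (a ℚ.* 1ℚ) ≡ 0ℚ
  cancel = solve-∀ ℚ-ring
  coefficient≡0 : lookup (lincomb 1ℚ g c f) t ≡ 0ℚ
  coefficient≡0 = begin
    lookup (lincomb 1ℚ g c f) t               ≡⟨ Vecₚ.lookup-zipWith _ t g f ⟩
    1ℚ ℚ.* gₜ ℚ.+ c ℚ.* fₜ                    ≡⟨ rearrange gₜ (ℚ.1/ fₜ) fₜ ⟩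
    gₜ ℚ.+ ℚ.- (gₜ ℚ.* (ℚ.1/ fₜ ℚ.* fₜ))
      ≡⟨ cong (λ z → gₜ ℚ.+ ℚ.- (gₜ ℚ.* z)) (ℚₚ.*-inverseˡ fₜ) ⟩
    gₜ ℚ.+ ℚ.- (gₜ ℚ.* 1ℚ)                    ≡⟨ cancel gₜ ⟩
    0ℚ                                        ∎

signs : Vec (Vec ℚ d) m → Vec ℚ d → Vec Sgn m
signs fs x = Vec.map (λ g → sgn (g · x)) fs

record Realizable (fs : Vec (Vec ℚ d) m) (σ : Vec Sgn m) : Set where
  constructor realizedAt
  field
    point    : Vec ℚ d
    realizes : signs fs point ≡ σ

realizable-tail : ∀ {f : Vec ℚ d} {fs : Vec (Vec ℚ d) m} {τ} →
                  Realizable (f ∷ fs) (s ∷ τ) → Realizable fs τ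
realizable-tail (realizedAt x f∷fs≡s∷τ) = realizedAt x (Vecₚ.∷-injectiveʳ f∷fs≡s∷τ)

realizable-eliminate : ∀ {f : Vec ℚ (suc d)} {fs : Vec (Vec ℚ (suc d)) m} {τ} t .{{_ : ℚ.NonZero (lookup f t)}} →
                       Realizable (f ∷ fs) (zer ∷ τ) → Realizable (Vec.map (eliminate f t) fs) τ
realizable-eliminate {f = f} {fs} {τ} t (realizedAt x f∷fs≡zer∷τ) = realizedAt (removeAt x t) (begin
  signs (Vec.map (eliminate f t) fs) (removeAt x t)  ≡⟨ Vecₚ.map-∘ _ (eliminate f t) fs ⟨
  Vec.map (λ g → sgn (eliminate f t g · removeAt x t)) fs
    ≡⟨ Vecₚ.map-cong (λ g → cong sgn (·-eliminate f t g x f·x≡0)) fs ⟩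
  signs fs x                                         ≡⟨ Vecₚ.∷-injectiveʳ f∷fs≡zer∷τ ⟩
  τ                                                  ∎)
  where
  open ≡-Reasoning
  f·x≡0 : f · x ≡ 0ℚ
  f·x≡0 = sgn≡zer⇒≡0 (Vecₚ.∷-injectiveˡ f∷fs≡zer∷τ)

signs-lincomb : ∀ {α β} (fs : Vec (Vec ℚ d) m) {x y τ} → 0ℚ ℚ.< α → 0ℚ ℚ.< β →
                signs fs x ≡ τ → signs fs y ≡ τ → signs fs (lincomb α x β y) ≡ τ
signs-lincomb []       {τ = []}    _   _   _  _  = refl
signs-lincomb {α = α} {β} (g ∷ fs) {x} {y} {s ∷ τ} α>0 β>0 gx gy = cong₂ _∷_
  (trans (cong sgn (·-lincombʳ α β g x y))
         (sgn-positiveCombination {g · x} {s} {g · y} α>0 β>0 (Vecₚ.∷-injectiveˡ gx) (Vecₚ.∷-injectiveˡ gy)))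
  (signs-lincomb fs α>0 β>0 (Vecₚ.∷-injectiveʳ gx) (Vecₚ.∷-injectiveʳ gy))

-- lincomb (f · y) x (- (f · x)) y is a positive multiple of the point where the segment
-- from x to y crosses the hyperplane f = 0.
realizable-crossing : ∀ {f : Vec ℚ d} {fs : Vec (Vec ℚ d) m} {τ} →
                      Realizable (f ∷ fs) (neg ∷ τ) → Realizable (f ∷ fs) (pos ∷ τ) →
                      Realizable (f ∷ fs) (zer ∷ τ)
realizable-crossing {f = f} {fs} (realizedAt x x-signs) (realizedAt y y-signs) =
  realizedAt (lincomb (f · y) x (ℚ.- (f · x)) y) (cong₂ _∷_ (cong sgn f·z≡0)
    (signs-lincomb fs f·y>0 (ℚₚ.neg-antimono-< f·x<0) (Vecₚ.∷-injectiveʳ x-signs) (Vecₚ.∷-injectiveʳ y-signs)))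
  where
  f·x<0 : f · x ℚ.< 0ℚ
  f·x<0 = sgn≡neg⇒<0 (Vecₚ.∷-injectiveˡ x-signs)
  f·y>0 : 0ℚ ℚ.< f · y
  f·y>0 = sgn≡pos⇒>0 (Vecₚ.∷-injectiveˡ y-signs)
  cross : ∀ a b → b ℚ.* a ℚ.+ ℚ.- a ℚ.* b ≡ 0ℚ
  cross = solve-∀ ℚ-ring
  f·z≡0 : f · lincomb (f · y) x (ℚ.- (f · x)) y ≡ 0ℚ
  f·z≡0 = trans (·-lincombʳ (f · y) (ℚ.- (f · x)) f x y) (cross (f · x) (f · y))

-- Counting realizable sign patterns

∑ : ∀ m → (Vec Sgn m → ℕ) → ℕ
∑ zero    g = g []
∑ (suc m) g = ∑ m (λ τ → g (neg ∷ τ) + g (zer ∷ τ) + g (pos ∷ τ))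

∑-mono-≤ : ∀ m {g h : Vec Sgn m → ℕ} → (∀ σ → g σ ≤ h σ) → ∑ m g ≤ ∑ m h
∑-mono-≤ zero    g≤h = g≤h []
∑-mono-≤ (suc m) g≤h = ∑-mono-≤ m (λ τ → ℕₚ.+-mono-≤ (ℕₚ.+-mono-≤ (g≤h _) (g≤h _)) (g≤h _))

∑-cong : ∀ m {g h : Vec Sgn m → ℕ} → (∀ σ → g σ ≡ h σ) → ∑ m g ≡ ∑ m h
∑-cong zero    g≡h = g≡h []
∑-cong (suc m) g≡h = ∑-cong m (λ τ → cong₂ _+_ (cong₂ _+_ (g≡h _) (g≡h _)) (g≡h _))

∑-distrib-+ : ∀ m (g h : Vec Sgn m → ℕ) → ∑ m (λ σ → g σ + h σ) ≡ ∑ m g + ∑ m h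
∑-distrib-+ zero    g h = refl
∑-distrib-+ (suc m) g h = trans (∑-cong m (λ τ → regroup (g (neg ∷ τ)) (h (neg ∷ τ)) (g (zer ∷ τ))
                                                         (h (zer ∷ τ)) (g (pos ∷ τ)) (h (pos ∷ τ))))
                                (∑-distrib-+ m _ _)
  where
  regroup : ∀ a a′ b b′ c c′ → a + a′ + (b + b′) + (c + c′) ≡ a + b + c + (a′ + b′ + c′)
  regroup = solve-∀ ℕ-ring

term≤∑ : ∀ m (g : Vec Sgn m → ℕ) σ → g σ ≤ ∑ m g
term≤∑ zero    g []      = ℕₚ.≤-refl
term≤∑ (suc m) g (s ∷ τ) = ℕₚ.≤-trans (term≤fibre s) (term≤∑ m _ τ)
  where
  term≤fibre : ∀ s → g (s ∷ τ) ≤ g (neg ∷ τ) + g (zer ∷ τ) + g (pos ∷ τ)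
  term≤fibre neg = ℕₚ.≤-trans (ℕₚ.m≤m+n _ _) (ℕₚ.m≤m+n _ _)
  term≤fibre zer = ℕₚ.≤-trans (ℕₚ.m≤n+m _ (g (neg ∷ τ))) (ℕₚ.m≤m+n _ _)
  term≤fibre pos = ℕₚ.m≤n+m _ _

𝟙 : Bool → ℕ
𝟙 true  = 1
𝟙 false = 0

count : (Vec Sgn m → Bool) → ℕ
count {m} p = ∑ m (λ σ → 𝟙 (p σ))

RealizesAll : Vec (Vec ℚ d) m → (Vec Sgn m → Bool) → Set
RealizesAll fs p = ∀ σ → T (p σ) → Realizable fs σ

projection : (Vec Sgn (suc m) → Bool) → Vec Sgn m → Bool
projection p τ = p (neg ∷ τ) ∨ p (zer ∷ τ) ∨ p (pos ∷ τ)

onHyperplane : (Vec Sgn (suc m) → Bool) → Vec Sgn m → Bool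
onHyperplane p τ = p (zer ∷ τ) ∨ p (neg ∷ τ) ∧ p (pos ∷ τ)

count-split : (p : Vec Sgn (suc m) → Bool) →
              count p ≤ count (projection p) + (count (onHyperplane p) + count (onHyperplane p))
count-split {m} p = begin
  count p
    ≤⟨ ∑-mono-≤ m (λ τ → fibre≤ (p (neg ∷ τ)) (p (zer ∷ τ)) (p (pos ∷ τ))) ⟩
  ∑ m (λ τ → 𝟙 (projection p τ) + (𝟙 (onHyperplane p τ) + 𝟙 (onHyperplane p τ)))
    ≡⟨ ∑-distrib-+ m _ _ ⟩
  count (projection p) + ∑ m (λ τ → 𝟙 (onHyperplane p τ) + 𝟙 (onHyperplane p τ))
    ≡⟨ cong (count (projection p) +_) (∑-distrib-+ m _ _) ⟩
  count (projection p) + (count (onHyperplane p) + count (onHyperplane p)) ∎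
  where
  open ℕₚ.≤-Reasoning
  fibre≤ : ∀ a b c → 𝟙 a + 𝟙 b + 𝟙 c ≤ 𝟙 (a ∨ b ∨ c) + (𝟙 (b ∨ a ∧ c) + 𝟙 (b ∨ a ∧ c))
  fibre≤ true  true  true  = ℕₚ.≤-refl
  fibre≤ true  true  false = ℕₚ.n≤1+n 2
  fibre≤ true  false true  = ℕₚ.n≤1+n 2
  fibre≤ true  false false = ℕₚ.≤-refl
  fibre≤ false true  true  = ℕₚ.n≤1+n 2
  fibre≤ false true  false = s≤s z≤n
  fibre≤ false false true  = ℕₚ.≤-refl
  fibre≤ false false false = ℕₚ.≤-refl

𝟙≡0 : ∀ b → ¬ T b → 𝟙 b ≡ 0
𝟙≡0 true  ¬t = contradiction _ ¬t
𝟙≡0 false _  = refl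

count-vanishing : ∀ {f : Vec ℚ d} {fs : Vec (Vec ℚ d) m} (p : Vec Sgn (suc m) → Bool) →
                  (∀ x → f · x ≡ 0ℚ) → RealizesAll (f ∷ fs) p → count p ≤ count (λ τ → p (zer ∷ τ))
count-vanishing {m = m} {f} p f≡0 realizable = ∑-mono-≤ m fibre≤
  where
  unrealizable : ∀ {s} τ → s ≢ zer → ¬ T (p (s ∷ τ))
  unrealizable τ s≢zer ps with realizable _ ps
  ... | realizedAt x f∷fs≡s∷τ = s≢zer (trans (sym (Vecₚ.∷-injectiveˡ f∷fs≡s∷τ)) (cong sgn (f≡0 x)))
  fibre≤ : ∀ τ → 𝟙 (p (neg ∷ τ)) + 𝟙 (p (zer ∷ τ)) + 𝟙 (p (pos ∷ τ)) ≤ 𝟙 (p (zer ∷ τ))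
  fibre≤ τ rewrite 𝟙≡0 (p (neg ∷ τ)) (unrealizable τ λ ()) | 𝟙≡0 (p (pos ∷ τ)) (unrealizable τ λ ()) =
    ℕₚ.≤-reflexive (ℕₚ.+-identityʳ _)

base-mono : ∀ m d → (1 + 2 * m) ^ d ≤ (1 + 2 * suc m) ^ d
base-mono m d = ℕₚ.^-monoˡ-≤ d (ℕₚ.+-monoʳ-≤ 1 (ℕₚ.*-monoʳ-≤ 2 (ℕₚ.n≤1+n m)))

bound-recurrence : ∀ m d → (1 + 2 * m) ^ suc d + ((1 + 2 * m) ^ d + (1 + 2 * m) ^ d) ≤ (1 + 2 * suc m) ^ suc d
bound-recurrence m d = begin
  (1 + 2 * m) * b + (b + b)     ≡⟨ regroup m b ⟩
  (1 + 2 * suc m) * b           ≤⟨ ℕₚ.*-monoʳ-≤ (1 + 2 * suc m) (base-mono m d) ⟩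
  (1 + 2 * suc m) ^ suc d       ∎
  where
  open ℕₚ.≤-Reasoning
  b = (1 + 2 * m) ^ d
  regroup : ∀ m b → (1 + 2 * m) * b + (b + b) ≡ (1 + 2 * (1 + m)) * b
  regroup = solve-∀ ℕ-ring

projection-realizable : ∀ {f : Vec ℚ d} {fs : Vec (Vec ℚ d) m} {p} →
                        RealizesAll (f ∷ fs) p → RealizesAll fs (projection p)
projection-realizable {p = p} realizable τ pτ with Equivalence.to T-∨ pτ
... | inj₁ p₋ = realizable-tail (realizable (neg ∷ τ) p₋)
... | inj₂ p₀₊ with Equivalence.to T-∨ p₀₊
...   | inj₁ p₀ = realizable-tail (realizable (zer ∷ τ) p₀)
...   | inj₂ p₊ = realizable-tail (realizable (pos ∷ τ) p₊)

onHyperplane-realizable : ∀ {f : Vec ℚ (suc d)} {fs : Vec (Vec ℚ (suc d)) m} {p} t .{{_ : ℚ.NonZero (lookup f t)}} →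
                          RealizesAll (f ∷ fs) p → RealizesAll (Vec.map (eliminate f t) fs) (onHyperplane p)
onHyperplane-realizable {p = p} t realizable τ pτ with Equivalence.to T-∨ pτ
... | inj₁ p₀  = realizable-eliminate t (realizable (zer ∷ τ) p₀)
... | inj₂ p₋₊ = let p₋ , p₊ = Equivalence.to T-∧ p₋₊ in
  realizable-eliminate t (realizable-crossing (realizable (neg ∷ τ) p₋) (realizable (pos ∷ τ) p₊))

count-realizable : (fs : Vec (Vec ℚ d) m) (p : Vec Sgn m → Bool) → RealizesAll fs p → count p ≤ (1 + 2 * m) ^ d
count-realizable {d} []       p _ = ℕₚ.≤-trans (𝟙≤1 (p [])) (ℕₚ.≤-reflexive (sym (ℕₚ.^-zeroˡ d)))
  where
  𝟙≤1 : ∀ b → 𝟙 b ≤ 1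
  𝟙≤1 true  = ℕₚ.≤-refl
  𝟙≤1 false = z≤n
count-realizable {d} {suc m} (f ∷ fs) p realizable with nonzeroCoefficient⊎vanishing f
... | inj₂ f≡0 = begin
  count p                    ≤⟨ count-vanishing p f≡0 realizable ⟩
  count (λ τ → p (zer ∷ τ))
    ≤⟨ count-realizable fs _ (λ τ pτ → realizable-tail (realizable (zer ∷ τ) pτ)) ⟩
  (1 + 2 * m) ^ d            ≤⟨ base-mono m d ⟩
  (1 + 2 * suc m) ^ d        ∎
  where open ℕₚ.≤-Reasoning
count-realizable {zero}  (f ∷ fs) p realizable | inj₁ (() , _)
count-realizable {suc d} {suc m} (f ∷ fs) p realizable | inj₁ (t , fₜ≢0) = begin
  count p                                                                    ≤⟨ count-split p ⟩
  count (projection p) + (count (onHyperplane p) + count (onHyperplane p))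
    ≤⟨ ℕₚ.+-mono-≤ (count-realizable fs _ (projection-realizable realizable))
                   (ℕₚ.+-mono-≤ hyperplane hyperplane) ⟩
  (1 + 2 * m) ^ suc d + ((1 + 2 * m) ^ d + (1 + 2 * m) ^ d)                  ≤⟨ bound-recurrence m d ⟩
  (1 + 2 * suc m) ^ suc d                                                    ∎
  where
  open ℕₚ.≤-Reasoning
  instance
    fₜ-nonZero : ℚ.NonZero (lookup f t)
    fₜ-nonZero = ℚ.≢-nonZero fₜ≢0
  hyperplane : count (onHyperplane p) ≤ (1 + 2 * m) ^ d
  hyperplane = count-realizable (Vec.map (eliminate f t) fs) _ (onHyperplane-realizable t realizable)

T-does : ∀ {A : Set} (a? : Dec A) → T (does a?) → A
T-does (yes a) _ = a

_≟ˢ_ : DecidableEquality Sgn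
neg ≟ˢ neg = yes refl
zer ≟ˢ zer = yes refl
pos ≟ˢ pos = yes refl
neg ≟ˢ zer = no λ ()
neg ≟ˢ pos = no λ ()
zer ≟ˢ neg = no λ ()
zer ≟ˢ pos = no λ ()
pos ≟ˢ neg = no λ ()
pos ≟ˢ zer = no λ ()

module _ {m : ℕ} where

  _≟ᵛ_ : DecidableEquality (Vec Sgn m)
  _≟ᵛ_ = Vecₚ.≡-dec _≟ˢ_

  open DecMembership _≟ᵛ_ using (_∈?_)

  length≤count-∈ : (σs : List (Vec Sgn m)) → Unique σs → length σs ≤ count (λ σ → does (σ ∈? σs))
  length≤count-∈ []        []                 = z≤n
  length≤count-∈ (σ₀ ∷ σs) (σ₀∉σs ∷ unique) = begin
    suc (length σs)
      ≡⟨ cong (λ b → 𝟙 b + length σs) (dec-true (σ₀ ≟ᵛ σ₀) refl) ⟨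
    𝟙 (does (σ₀ ≟ᵛ σ₀)) + length σs
      ≤⟨ ℕₚ.+-mono-≤ (term≤∑ m _ σ₀) (length≤count-∈ σs unique) ⟩
    count (λ σ → does (σ ≟ᵛ σ₀)) + count (λ σ → does (σ ∈? σs))
      ≡⟨ ∑-distrib-+ m _ _ ⟨
    ∑ m (λ σ → 𝟙 (does (σ ≟ᵛ σ₀)) + 𝟙 (does (σ ∈? σs)))
      ≤⟨ ∑-mono-≤ m fibre≤ ⟩
    count (λ σ → does (σ ∈? σ₀ ∷ σs)) ∎
    where
    open ℕₚ.≤-Reasoning
    fibre≤ : ∀ σ → 𝟙 (does (σ ≟ᵛ σ₀)) + 𝟙 (does (σ ∈? σs)) ≤ 𝟙 (does (σ ∈? σ₀ ∷ σs))
    fibre≤ σ with σ ≟ᵛ σ₀ | σ ∈? σs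
    ... | yes refl | yes σ₀∈σs = contradiction σ₀∈σs (All¬⇒¬Any σ₀∉σs)
    ... | yes _    | no _      = ℕₚ.≤-refl
    ... | no _     | _         = ℕₚ.≤-refl

  length≤-realizable : ∀ (fs : Vec (Vec ℚ d) m) (σs : List (Vec Sgn m)) → Unique σs →
                       All (Realizable fs) σs → length σs ≤ (1 + 2 * m) ^ d
  length≤-realizable fs σs unique realizable = ℕₚ.≤-trans (length≤count-∈ σs unique)
    (count-realizable fs _ (λ σ σ∈σs → All.lookup realizable (T-does (σ ∈? σs) σ∈σs)))

-- 3SUM-types as sign patterns

unitVector : ∀ {n} → Fin n → Vec ℚ n
unitVector {suc n} zero    = 1ℚ ∷ replicate n 0ℚ
unitVector         (suc i) = 0ℚ ∷ unitVector i

·-replicate-0 : (v : Vec ℚ d) → replicate d 0ℚ · v ≡ 0ℚ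
·-replicate-0 []      = refl
·-replicate-0 (a ∷ v) = cong₂ ℚ._+_ (ℚₚ.*-zeroˡ a) (·-replicate-0 v)

·-unitVector : (i : Fin d) (v : Vec ℚ d) → unitVector i · v ≡ lookup v i
·-unitVector zero    (a ∷ v) = trans (cong₂ ℚ._+_ (ℚₚ.*-identityˡ a) (·-replicate-0 v)) (ℚₚ.+-identityʳ a)
·-unitVector (suc i) (a ∷ v) = trans (cong₂ ℚ._+_ (ℚₚ.*-zeroˡ a) (·-unitVector i v)) (ℚₚ.+-identityˡ _)

·-++ : ∀ {d′} (u v : Vec ℚ d) (u′ v′ : Vec ℚ d′) → (u ++ u′) · (v ++ v′) ≡ u · v ℚ.+ u′ · v′
·-++ []      []      u′ v′ = sym (ℚₚ.+-identityˡ _)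
·-++ (a ∷ u) (b ∷ v) u′ v′ = trans (cong (a ℚ.* b ℚ.+_) (·-++ u v u′ v′)) (sym (ℚₚ.+-assoc (a ℚ.* b) _ _))

module _ {N : ℕ} where

  Triple : Set
  Triple = Fin N × Fin N × Fin N

  triple : Fin (N * (N * N)) → Triple
  triple r = map₂ (remQuot {N} N) (remQuot {N} (N * N) r)

  triple-combine : ∀ i j k → triple (combine i (combine j k)) ≡ (i , j , k)
  triple-combine i j k = trans (cong (map₂ (remQuot {N} N)) (Finₚ.remQuot-combine i (combine j k)))
                                (cong (i ,_) (Finₚ.remQuot-combine j k))

  flatten : Type3 N → Vec Sgn (N * (N * N))
  flatten χ = tabulate (λ r → let i , j , k = triple r in χ i j k)

  flatten-cong : ∀ {χ χ′} → χ ≈ᵗ χ′ → flatten χ ≡ flatten χ′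
  flatten-cong χ≈χ′ = Vecₚ.tabulate-cong (λ r → χ≈χ′ _ _ _)

  flatten-injective : ∀ {χ χ′} → flatten χ ≡ flatten χ′ → χ ≈ᵗ χ′
  flatten-injective {χ} {χ′} flat≡ i j k = begin
    χ i j k                                       ≡⟨ lookup-flatten χ ⟨
    lookup (flatten χ) (combine i (combine j k))  ≡⟨ cong (λ v → lookup v (combine i (combine j k))) flat≡ ⟩
    lookup (flatten χ′) (combine i (combine j k)) ≡⟨ lookup-flatten χ′ ⟩
    χ′ i j k                                      ∎
    where
    open ≡-Reasoning
    lookup-flatten : ∀ χ → lookup (flatten χ) (combine i (combine j k)) ≡ χ i j k
    lookup-flatten χ = trans (Vecₚ.lookup∘tabulate _ (combine i (combine j k)))
                             (cong (λ (i , j , k) → χ i j k) (triple-combine i j k))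

  sumForm : Triple → Vec ℚ (N + (N + N))
  sumForm (i , j , k) = unitVector i ++ (unitVector j ++ unitVector k)

  sumForms : Vec (Vec ℚ (N + (N + N))) (N * (N * N))
  sumForms = tabulate (sumForm ∘ triple)

  instancePoint : Instance N → Vec ℚ (N + (N + N))
  instancePoint I = tabulate a ++ (tabulate b ++ tabulate c)
    where open Instance I

  sumForm-instancePoint : ∀ I i j k → let open Instance I in
                          sumForm (i , j , k) · instancePoint I ≡ a i ℚ.+ b j ℚ.+ c k
  sumForm-instancePoint I i j k = begin
    sumForm (i , j , k) · instancePoint I
      ≡⟨ ·-++ (unitVector i) (tabulate a) _ _ ⟩
    unitVector i · tabulate a ℚ.+ (unitVector j ++ unitVector k) · (tabulate b ++ tabulate c)
      ≡⟨ cong (unitVector i · tabulate a ℚ.+_) (·-++ (unitVector j) (tabulate b) _ _) ⟩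
    unitVector i · tabulate a ℚ.+ (unitVector j · tabulate b ℚ.+ unitVector k · tabulate c)
      ≡⟨ cong₂ ℚ._+_ (entry a i) (cong₂ ℚ._+_ (entry b j) (entry c k)) ⟩
    a i ℚ.+ (b j ℚ.+ c k)
      ≡⟨ ℚₚ.+-assoc (a i) (b j) (c k) ⟨
    a i ℚ.+ b j ℚ.+ c k ∎
    where
    open Instance I
    open ≡-Reasoning
    entry : ∀ (x : Fin N → ℚ) i → unitVector i · tabulate x ≡ x i
    entry x i = trans (·-unitVector i (tabulate x)) (Vecₚ.lookup∘tabulate x i)

  signs-instancePoint : ∀ I → signs sumForms (instancePoint I) ≡ flatten (typeOf I)
  signs-instancePoint I = trans (sym (Vecₚ.tabulate-∘ _ _)) (Vecₚ.tabulate-cong λ r →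
    let i , j , k = triple r in cong sgn (sumForm-instancePoint I i j k))

  isType-realizable : ∀ {χ} → IsType N χ → Realizable sumForms (flatten χ)
  isType-realizable (I , I≈χ) = realizedAt (instancePoint I) (trans (signs-instancePoint I) (flatten-cong I≈χ))

types-atMost : ∀ N → AtMostTypes N ((1 + 2 * (N * (N * N))) ^ (N + (N + N)))
types-atMost N L (areTypes , distinct) = begin
  length L                    ≡⟨ Listₚ.length-map flatten L ⟨
  length (List.map flatten L) ≤⟨ length≤-realizable (sumForms {N}) _ unique realizable ⟩
  (1 + 2 * (N * (N * N))) ^ (N + (N + N)) ∎
  where
  open ℕₚ.≤-Reasoning
  unique : Unique (List.map flatten L)
  unique = AllPairsₚ.map⁺ (AllPairs.map (λ χ≉χ′ → χ≉χ′ ∘ flatten-injective) distinct)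
  realizable : All (Realizable (sumForms {N})) (List.map flatten L)
  realizable = Allₚ.map⁺ (All.map isType-realizable areTypes)

-- Instances with pairwise distinct types

ι : ℕ → ℚ
ι zero    = 0ℚ
ι (suc n) = 1ℚ ℚ.+ ι n

ι-+ : ∀ m n → ι (m + n) ≡ ι m ℚ.+ ι n
ι-+ zero    n = sym (ℚₚ.+-identityˡ (ι n))
ι-+ (suc m) n = trans (cong (1ℚ ℚ.+_) (ι-+ m n)) (sym (ℚₚ.+-assoc 1ℚ (ι m) (ι n)))

ι-nonNeg : ∀ n → 0ℚ ℚ.≤ ι n
ι-nonNeg zero    = ℚₚ.≤-refl
ι-nonNeg (suc n) = ℚₚ.+-mono-≤ (ℚₚ.<⇒≤ (ℚₚ.positive⁻¹ 1ℚ)) (ι-nonNeg n)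

ι-mono-< : ∀ {m n} → m < n → ι m ℚ.< ι n
ι-mono-< {zero}  {suc n} _         = ℚₚ.+-mono-<-≤ (ℚₚ.positive⁻¹ 1ℚ) (ι-nonNeg n)
ι-mono-< {suc m} {suc n} (s≤s m<n) = ℚₚ.+-monoʳ-< 1ℚ (ι-mono-< m<n)

sgn[ιs-ιt]≡neg : ∀ {s t} → s < t → sgn (ι s ℚ.- ι t) ≡ neg
sgn[ιs-ιt]≡neg {s} {t} s<t = <0⇒sgn≡neg
  (subst (ι s ℚ.- ι t ℚ.<_) (ℚₚ.+-inverseʳ (ι t)) (ℚₚ.+-monoˡ-< (ℚ.- ι t) (ι-mono-< s<t)))

sgn[ιt-ιt]≡zer : ∀ t → sgn (ι t ℚ.- ι t) ≡ zer
sgn[ιt-ιt]≡zer t = cong sgn (ℚₚ.+-inverseʳ (ι t))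

threshold : ℕ → ℕ
threshold N = suc N * N + N

module _ {N : ℕ} (f : Fin N → Fin (suc N)) where

  encodingInstance : Instance N
  encodingInstance = record
    { a = λ i → ι (suc N * suc (toℕ i))
    ; b = λ j → ι (toℕ j)
    ; c = λ k → ι (toℕ (combine k (f k))) ℚ.- ι (threshold N)
    ; a-inc = λ i j i<j → ι-mono-< (ℕₚ.*-monoʳ-< (suc N) (s≤s i<j))
    ; b-inc = λ i j i<j → ι-mono-< i<j
    ; c-inc = λ i j i<j → ℚₚ.+-monoˡ-< (ℚ.- ι (threshold N)) (ι-mono-< (Finₚ.combine-monoˡ-< (f i) (f j) i<j))
    }

  antidiagonal-sum : ∀ (k j : Fin N) → suc N * suc (toℕ (opposite k)) + toℕ j + toℕ (combine k (f k))
                                       ≡ suc N * N + (toℕ j + toℕ (f k))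
  antidiagonal-sum k j = begin
    suc N * suc o + toℕ j + toℕ (combine k (f k))
      ≡⟨ cong (suc N * suc o + toℕ j +_) (Finₚ.toℕ-combine k (f k)) ⟩
    suc N * suc o + toℕ j + (suc N * toℕ k + toℕ (f k))
      ≡⟨ regroup (suc N) (suc o) (toℕ j) (toℕ k) (toℕ (f k)) ⟩
    suc N * (suc o + toℕ k) + (toℕ j + toℕ (f k))
      ≡⟨ cong (λ n → suc N * n + (toℕ j + toℕ (f k))) opposite+k ⟩
    suc N * N + (toℕ j + toℕ (f k)) ∎
    where
    open ≡-Reasoning
    o = toℕ (opposite k)
    regroup : ∀ p q x y z → p * q + x + (p * y + z) ≡ p * (q + y) + (x + z)
    regroup = solve-∀ ℕ-ring
    opposite+k : suc o + toℕ k ≡ N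
    opposite+k = begin
      suc o + toℕ k                 ≡⟨ ℕₚ.+-suc o (toℕ k) ⟨
      o + suc (toℕ k)               ≡⟨ cong (_+ suc (toℕ k)) (Finₚ.opposite-prop k) ⟩
      N ∸ suc (toℕ k) + suc (toℕ k) ≡⟨ ℕₚ.m∸n+n≡m (Finₚ.toℕ<n k) ⟩
      N                             ∎

  typeOf-antidiagonal : ∀ (k j : Fin N) → typeOf encodingInstance (opposite k) j k
                                          ≡ sgn (ι (suc N * N + (toℕ j + toℕ (f k))) ℚ.- ι (threshold N))
  typeOf-antidiagonal k j = cong sgn (begin
    ι x ℚ.+ ι y ℚ.+ (ι z ℚ.- ι t)  ≡⟨ ℚₚ.+-assoc (ι x ℚ.+ ι y) (ι z) (ℚ.- ι t) ⟨
    ι x ℚ.+ ι y ℚ.+ ι z ℚ.- ι t    ≡⟨ cong (λ q → q ℚ.+ ι z ℚ.- ι t) (ι-+ x y) ⟨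
    ι (x + y) ℚ.+ ι z ℚ.- ι t      ≡⟨ cong (ℚ._- ι t) (ι-+ (x + y) z) ⟨
    ι (x + y + z) ℚ.- ι t          ≡⟨ cong (λ n → ι n ℚ.- ι t) (antidiagonal-sum k j) ⟩
    ι (suc N * N + (toℕ j + toℕ (f k))) ℚ.- ι t ∎)
    where
    open ≡-Reasoning
    x = suc N * suc (toℕ (opposite k))
    y = toℕ j
    z = toℕ (combine k (f k))
    t = threshold N

types-differ : ∀ {N} (f g : Fin N → Fin (suc N)) k → toℕ (f k) < toℕ (g k) →
               ¬ typeOf (encodingInstance f) ≈ᵗ typeOf (encodingInstance g)
types-differ {N} f g k fₖ<gₖ same = neg≢zer (begin
  neg                                                     ≡⟨ sgn[ιs-ιt]≡neg (ℕₚ.+-monoʳ-< (suc N * N) j+fₖ<N) ⟨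
  sgn (ι (suc N * N + (toℕ j + fₖ)) ℚ.- ι (threshold N))  ≡⟨ typeOf-antidiagonal f k j ⟨
  typeOf (encodingInstance f) (opposite k) j k            ≡⟨ same (opposite k) j k ⟩
  typeOf (encodingInstance g) (opposite k) j k            ≡⟨ typeOf-antidiagonal g k j ⟩
  sgn (ι (suc N * N + (toℕ j + gₖ)) ℚ.- ι (threshold N))
    ≡⟨ cong (λ n → sgn (ι (suc N * N + n) ℚ.- ι (threshold N))) j+gₖ≡N ⟩
  sgn (ι (threshold N) ℚ.- ι (threshold N))               ≡⟨ sgn[ιt-ιt]≡zer (threshold N) ⟩
  zer                                                     ∎)
  where
  open ≡-Reasoning
  fₖ = toℕ (f k)
  gₖ = toℕ (g k)
  neg≢zer : neg ≢ zer
  neg≢zer ()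
  gₖ≤N : gₖ ≤ N
  gₖ≤N = ℕ.s≤s⁻¹ (Finₚ.toℕ<n (g k))
  N∸gₖ<N : N ∸ gₖ < N
  N∸gₖ<N = ℕₚ.∸-monoʳ-< (ℕₚ.≤-<-trans z≤n fₖ<gₖ) gₖ≤N
  j : Fin N
  j = fromℕ< N∸gₖ<N
  j+gₖ≡N : toℕ j + gₖ ≡ N
  j+gₖ≡N = trans (cong (_+ gₖ) (Finₚ.toℕ-fromℕ< N∸gₖ<N)) (ℕₚ.m∸n+n≡m gₖ≤N)
  j+fₖ<N : toℕ j + fₖ < N
  j+fₖ<N = subst (toℕ j + fₖ <_) j+gₖ≡N (ℕₚ.+-monoʳ-< (toℕ j) fₖ<gₖ)

encodingInstance-injective : ∀ {N} (f g : Fin N → Fin (suc N)) →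
                             typeOf (encodingInstance f) ≈ᵗ typeOf (encodingInstance g) → f ≗ g
encodingInstance-injective f g same k with Finₚ.<-cmp (f k) (g k)
... | tri< fₖ<gₖ _ _ = contradiction same (types-differ f g k fₖ<gₖ)
... | tri≈ _ fₖ≡gₖ _ = fₖ≡gₖ
... | tri> _ _ gₖ<fₖ = contradiction (λ i j k → sym (same i j k)) (types-differ g f k gₖ<fₖ)

funToFin-cong : ∀ {m n} {f g : Fin m → Fin n} → f ≗ g → funToFin f ≡ funToFin g
funToFin-cong {zero}  _   = refl
funToFin-cong {suc m} f≗g = cong₂ combine (f≗g zero) (funToFin-cong (f≗g ∘ suc))

finToFun-injective : ∀ {k n} {r r′ : Fin (k ^ n)} → finToFun {k} {n} r ≗ finToFun r′ → r ≡ r′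
finToFun-injective {k} {n} {r} {r′} r≗r′ =
  trans (sym (Finₚ.funToFin-finToFin {n} {k} r)) (trans (funToFin-cong r≗r′) (Finₚ.funToFin-finToFin {n} {k} r′))

types-atLeast : ∀ N → AtLeastTypes N (suc N ^ N)
types-atLeast N = List.map χ (allFin (suc N ^ N)) , (areTypes , distinct) , ℕₚ.≤-reflexive (sym length≡)
  where
  χ : Fin (suc N ^ N) → Type3 N
  χ r = typeOf (encodingInstance (finToFun r))
  areTypes : All (IsType N) (List.map χ (allFin (suc N ^ N)))
  areTypes = Allₚ.map⁺ (All.universal (λ r → encodingInstance (finToFun r) , λ _ _ _ → refl) _)
  distinct : AllPairs.AllPairs (λ χ χ′ → ¬ χ ≈ᵗ χ′) (List.map χ (allFin (suc N ^ N)))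
  distinct = AllPairsₚ.map⁺ (AllPairs.map
    (λ r≢r′ → r≢r′ ∘ finToFun-injective {suc N} {N} ∘ encodingInstance-injective _ _) (Uniqueₚ.allFin⁺ (suc N ^ N)))
  length≡ : length (List.map χ (allFin (suc N ^ N))) ≡ suc N ^ N
  length≡ = trans (Listₚ.length-map χ (allFin _)) (Listₚ.length-tabulate id)

-- Estimates

2*⌊n/2⌋≤n : ∀ n → 2 * ⌊ n /2⌋ ≤ n
2*⌊n/2⌋≤n n = begin
  2 * ⌊ n /2⌋          ≡⟨ cong (⌊ n /2⌋ +_) (ℕₚ.+-identityʳ ⌊ n /2⌋) ⟩
  ⌊ n /2⌋ + ⌊ n /2⌋    ≤⟨ ℕₚ.+-monoʳ-≤ ⌊ n /2⌋ (ℕₚ.⌊n/2⌋≤⌈n/2⌉ n) ⟩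
  ⌊ n /2⌋ + ⌈ n /2⌉    ≡⟨ ℕₚ.⌊n/2⌋+⌈n/2⌉≡n n ⟩
  n                    ∎
  where open ℕₚ.≤-Reasoning

2^⌊log₂n⌋≤n : ∀ {n} → 1 ≤ n → 2 ^ ⌊log₂ n ⌋ ≤ n
2^⌊log₂n⌋≤n {suc n} _ = <-rec (λ n → 2 ^ ⌊log₂ suc n ⌋ ≤ suc n) step n
  where
  open ℕₚ.≤-Reasoning
  step : ∀ n → (∀ {m} → m < n → 2 ^ ⌊log₂ suc m ⌋ ≤ suc m) → 2 ^ ⌊log₂ suc n ⌋ ≤ suc n
  step zero    _   = ℕₚ.≤-refl
  -- ⌊log₂ (2 + k)⌋ unfolds to suc ⌊log₂ (suc ⌊ k /2⌋)⌋ only up to the accessibility proof.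
  step (suc k) rec = begin
    2 ^ ⌊log₂ (2 + k) ⌋               ≡⟨ cong (λ e → 2 ^ suc e) (⌊log2⌋-acc-irrelevant (suc ⌊ k /2⌋)) ⟩
    2 * 2 ^ ⌊log₂ suc ⌊ k /2⌋ ⌋       ≤⟨ ℕₚ.*-monoʳ-≤ 2 (rec (s≤s (ℕₚ.⌊n/2⌋≤n k))) ⟩
    2 * suc ⌊ k /2⌋                   ≡⟨ ℕₚ.*-suc 2 ⌊ k /2⌋ ⟩
    2 + 2 * ⌊ k /2⌋                   ≤⟨ ℕₚ.+-monoʳ-≤ 2 (2*⌊n/2⌋≤n k) ⟩
    2 + k                             ∎

n<2^[1+⌊log₂n⌋] : ∀ n → n < 2 ^ suc ⌊log₂ n ⌋
n<2^[1+⌊log₂n⌋] n with n ℕ.<? 2 ^ suc ⌊log₂ n ⌋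
... | yes n<2^ = n<2^
... | no  n≮2^ = contradiction
  (subst (_≤ ⌊log₂ n ⌋) (⌊log₂[2^n]⌋≡n (suc ⌊log₂ n ⌋)) (⌊log₂⌋-mono-≤ (ℕₚ.≮⇒≥ n≮2^)))
  (ℕₚ.n≮n ⌊log₂ n ⌋)

n≤4^⌊log₂n⌋ : ∀ {n} → 2 ≤ n → n ≤ 2 ^ (2 * ⌊log₂ n ⌋)
n≤4^⌊log₂n⌋ {n} 2≤n = ℕₚ.≤-trans (ℕₚ.<⇒≤ (n<2^[1+⌊log₂n⌋] n)) (ℕₚ.^-monoʳ-≤ 2 (begin
  1 + ℓ        ≤⟨ ℕₚ.+-monoˡ-≤ ℓ (⌊log₂⌋-mono-≤ 2≤n) ⟩
  ℓ + ℓ        ≡⟨ cong (ℓ +_) (ℕₚ.+-identityʳ ℓ) ⟨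
  2 * ℓ        ∎))
  where
  open ℕₚ.≤-Reasoning
  ℓ = ⌊log₂ n ⌋

1+2n³≤n⁵ : ∀ {n} → 2 ≤ n → 1 + 2 * (n * (n * n)) ≤ n ^ 5
1+2n³≤n⁵ {n} 2≤n = begin
  1 + 2 * n³       ≤⟨ ℕₚ.+-monoˡ-≤ (2 * n³) (ℕₚ.*-mono-≤ 1≤n (ℕₚ.*-mono-≤ 1≤n 1≤n)) ⟩
  n³ + 2 * n³      ≡⟨⟩
  3 * n³           ≤⟨ ℕₚ.*-monoˡ-≤ n³ (ℕₚ.≤-trans (ℕₚ.n≤1+n 3) (ℕₚ.*-mono-≤ 2≤n 2≤n)) ⟩
  n * n * n³       ≡⟨ fifth n ⟩
  n ^ 5            ∎
  where
  open ℕₚ.≤-Reasoning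
  n³ = n * (n * n)
  1≤n : 1 ≤ n
  1≤n = ℕₚ.≤-trans (s≤s z≤n) 2≤n
  -- The right-hand side is n ^ 5 unfolded: the ring solver does not accept _^_.
  fifth : ∀ n → n * n * (n * (n * n)) ≡ n * (n * (n * (n * (n * 1))))
  fifth = solve-∀ ℕ-ring

[1+2n³]^[3n]≤2^[30n⌊log₂n⌋] : ∀ {n} → 2 ≤ n →
                              (1 + 2 * (n * (n * n))) ^ (n + (n + n)) ≤ 2 ^ (30 * (n * ⌊log₂ n ⌋))
[1+2n³]^[3n]≤2^[30n⌊log₂n⌋] {n} 2≤n = begin
  (1 + 2 * (n * (n * n))) ^ 3n   ≤⟨ ℕₚ.^-monoˡ-≤ 3n (1+2n³≤n⁵ 2≤n) ⟩
  (n ^ 5) ^ 3n                   ≤⟨ ℕₚ.^-monoˡ-≤ 3n (ℕₚ.^-monoˡ-≤ 5 (n≤4^⌊log₂n⌋ 2≤n)) ⟩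
  ((2 ^ (2 * ℓ)) ^ 5) ^ 3n       ≡⟨ cong (_^ 3n) (ℕₚ.^-*-assoc 2 (2 * ℓ) 5) ⟩
  (2 ^ (2 * ℓ * 5)) ^ 3n         ≡⟨ ℕₚ.^-*-assoc 2 (2 * ℓ * 5) 3n ⟩
  2 ^ (2 * ℓ * 5 * 3n)           ≡⟨ cong (2 ^_) (exponent ℓ n) ⟩
  2 ^ (30 * (n * ℓ))             ∎
  where
  open ℕₚ.≤-Reasoning
  ℓ = ⌊log₂ n ⌋
  3n = n + (n + n)
  exponent : ∀ ℓ n → 2 * ℓ * 5 * (n + (n + n)) ≡ 30 * (n * ℓ)
  exponent = solve-∀ ℕ-ring

2^[n⌊log₂n⌋/c]≤[1+n]^n : ∀ {n} c .{{_ : ℕ.NonZero c}} → 1 ≤ n → 2 ^ ((n * ⌊log₂ n ⌋) / c) ≤ suc n ^ n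
2^[n⌊log₂n⌋/c]≤[1+n]^n {n} c 1≤n = begin
  2 ^ ((n * ℓ) / c)  ≤⟨ ℕₚ.^-monoʳ-≤ 2 (m/n≤m (n * ℓ) c) ⟩
  2 ^ (n * ℓ)        ≡⟨ cong (2 ^_) (ℕₚ.*-comm n ℓ) ⟩
  2 ^ (ℓ * n)        ≡⟨ ℕₚ.^-*-assoc 2 ℓ n ⟨
  (2 ^ ℓ) ^ n        ≤⟨ ℕₚ.^-monoˡ-≤ n (ℕₚ.≤-trans (2^⌊log₂n⌋≤n 1≤n) (ℕₚ.n≤1+n n)) ⟩
  suc n ^ n          ∎
  where
  open ℕₚ.≤-Reasoning
  ℓ = ⌊log₂ n ⌋

lemma2 : ∃[ c ] ∃[ N₀ ] (∀ N → N₀ ≤ N →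
           AtLeastTypes N (2 ^ ((N * ⌊log₂ N ⌋) / suc c))
           × AtMostTypes N (2 ^ (suc c * (N * ⌊log₂ N ⌋))))
lemma2 = 29 , 2 , λ N 2≤N → atLeast N 2≤N , atMost N 2≤N
  where
  atLeast : ∀ N → 2 ≤ N → AtLeastTypes N (2 ^ ((N * ⌊log₂ N ⌋) / 30))
  atLeast N 2≤N with L , distinctTypes , [1+N]^N≤|L| ← types-atLeast N =
    L , distinctTypes , ℕₚ.≤-trans (2^[n⌊log₂n⌋/c]≤[1+n]^n 30 (ℕₚ.≤-trans (s≤s z≤n) 2≤N)) [1+N]^N≤|L|
  atMost : ∀ N → 2 ≤ N → AtMostTypes N (2 ^ (30 * (N * ⌊log₂ N ⌋)))
  atMost N 2≤N L distinctTypes = ℕₚ.≤-trans (types-atMost N L distinctTypes) ([1+2n³]^[3n]≤2^[30n⌊log₂n⌋] 2≤N)
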